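{- Let $d$ and $e$ be graphic elements of $\mathcal{P}_{s,n}$. If $d\succeq e$ and $\{i,j\}$ is a forced pair for $e$, then $\{i,j\}$ is a forced pair for $d$.
   Context: $\mathcal{P}_{s,n}$ is the set of nonincreasing lists of $n$ nonnegative integers with sum $s$, partially ordered by dominance: $a\succeq b$ if $\sum_i a_i=\sum_i b_i$ and $\sum_{i=1}^j a_i\ge\sum_{i=1}^j b_i$ for every $j$. A list is graphic if it is the degree sequence of a (finite simple) graph. Realizations of $d=(d_1,\dots,d_n)$ are labeled graphs on vertex set $[n]$ in which vertex $\ell$ has degree $d_\ell$. A pair $\{i,j\}$ is a forced edge (resp. forced non-edge) for $d$ if $i,j$ are adjacent in every (resp. no) realization of $d$; a forced pair is a forced edge or forced non-edge. -}

module Defs where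

open import Data.Nat using (ℕ; _≤_; _≥_)
open import Data.Fin using (Fin; _<_)
open import Data.Bool using (Bool; true; false)
open import Data.List using (List; map; take; filter; length; allFin)
open import Data.Nat.ListAction using (sum)
open import Data.Product using (Σ; _×_; ∃)
open import Relation.Binary.PropositionalEquality using (_≡_; _≢_)
open import Data.Bool.Properties using (T?)

-- A degree list of length n: entry ℓ is d ℓ (vertices are Fin n, i.e. [n] shifted by 1).
Seq : ℕ → Set
Seq n = Fin n → ℕ

total : ∀ {n} → Seq n → ℕ
total {n} d = sum (map d (allFin n))

prefixSum : ∀ {n} → Seq n → ℕ → ℕ
prefixSum {n} d j = sum (map d (take j (allFin n)))

Nonincreasing : ∀ {n} → Seq n → Set
Nonincreasing d = ∀ i j → i < j → d j ≤ d i

InP : (s n : ℕ) → Seq n → Set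
InP s n d = Nonincreasing d × total d ≡ s

_⪰_ : ∀ {n} → Seq n → Seq n → Set
_⪰_ {n} a b = total a ≡ total b × (∀ j → prefixSum a j ≥ prefixSum b j)

record Graph (n : ℕ) : Set where
  field
    adj   : Fin n → Fin n → Bool
    sym   : ∀ i j → adj i j ≡ adj j i
    loopless : ∀ i → adj i i ≡ false
open Graph public

degree : ∀ {n} → Graph n → Fin n → ℕ
degree {n} G i = length (filter (λ j → T? (adj G i j)) (allFin n))

Realizes : ∀ {n} → Graph n → Seq n → Set
Realizes G d = ∀ ℓ → degree G ℓ ≡ d ℓ

Graphic : ∀ {n} → Seq n → Set
Graphic {n} d = Σ (Graph n) (λ G → Realizes G d)

ForcedEdge : ∀ {n} → Seq n → Fin n → Fin n → Set
ForcedEdge {n} d i j = ∀ (G : Graph n) → Realizes G d → adj G i j ≡ true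

ForcedNonEdge : ∀ {n} → Seq n → Fin n → Fin n → Set
ForcedNonEdge {n} d i j = ∀ (G : Graph n) → Realizes G d → adj G i j ≡ false

data ForcedPair {n : ℕ} (d : Seq n) (i j : Fin n) : Set where
  edge    : ForcedEdge d i j → ForcedPair d i j
  nonEdge : ForcedNonEdge d i j → ForcedPair d i j

module Submission where

-- Dominance is generated by unit transfers: if d ⪰ e and e is nonincreasing,
-- then e is reached from d by finitely many moves, each taking one unit from an
-- entry d a to an entry d b with d a ≥ d b + 2.  Each such move can be mirrored on
-- realizations: if G realizes d, then a has at least d a - d b ≥ 2 "private"
-- neighbours c (adjacent to a, not to b, c ≠ b), and replacing the edge ac by bc
-- gives a realization of the moved sequence.  Two distinct private neighbours
-- cannot both make the switch touch the pair {i,j}, so one of them leaves the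
-- adjacency of i and j unchanged.  Hence every realization of d can be turned into
-- a realization of e with the same adjacency on {i,j}, which transfers forcedness.

open import Defs hiding (sym)
open import Data.Nat using (ℕ; zero; suc; _+_; _∸_; _≤_; _<_; z≤n; s≤s; s≤s⁻¹)
open import Data.Nat.Properties hiding (_≟_)
open import Data.Fin using (Fin; zero; suc; _≟_)
import Data.Fin.Properties as Fin
open import Data.Bool using (Bool; true; false; if_then_else_)
open import Data.List using (List; []; _∷_; map; take; filter; length; allFin; tabulate)
open import Data.List.Properties using (map-tabulate; take-map)
open import Data.Nat.ListAction using (sum)
open import Data.Vec.Functional using (head; tail; updateAt) renaming (_∷_ to _◂_)
open import Data.Vec.Functional.Properties using (updateAt-updates; updateAt-minimal)
open import Data.Product using (Σ; _×_; _,_)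
open import Data.Sum using (_⊎_; inj₁; inj₂)
open import Data.Empty using (⊥-elim)
open import Function using (id; _∘_)
open import Relation.Nullary using (¬_; Dec; yes; no; does)
open import Relation.Nullary.Decidable using (dec-true; dec-false; T?; _×-dec_; _⊎-dec_)
open import Relation.Binary.PropositionalEquality
open import Data.Nat.Solver using (module +-*-Solver)
open +-*-Solver using (solve; _:+_; _:=_)

-- 1. Sums of finite sequences

total-cons : ∀ {n} (d : Seq (suc n)) → total d ≡ head d + total (tail d)
total-cons {n} d = cong (λ xs → d zero + sum xs)
  (trans (map-tabulate suc d) (sym (map-tabulate id (tail d))))

prefixSum-cons : ∀ {n} (d : Seq (suc n)) j → prefixSum d (suc j) ≡ head d + prefixSum (tail d) j
prefixSum-cons {n} d j = cong (λ xs → d zero + sum xs)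
  (trans (sym (take-map j (tabulate suc)))
  (trans (cong (take j) (trans (map-tabulate suc d) (sym (map-tabulate id (tail d)))))
  (take-map j (tabulate id))))

-- Sequences are functions, so totals must be shown to respect pointwise equality.
total-cong : ∀ {n} (f g : Seq n) → (∀ t → f t ≡ g t) → total f ≡ total g
total-cong {zero} f g f≗g = refl
total-cong {suc n} f g f≗g = begin
  total f                     ≡⟨ total-cons f ⟩
  f zero + total (tail f)     ≡⟨ cong₂ _+_ (f≗g zero) (total-cong (tail f) (tail g) (f≗g ∘ suc)) ⟩
  g zero + total (tail g)     ≡⟨ total-cons g ⟨
  total g                     ∎
  where open ≡-Reasoning

total-mono : ∀ {n} (f g : Seq n) → (∀ t → f t ≤ g t) → total f ≤ total g
total-mono {zero} f g f≤g = z≤n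
total-mono {suc n} f g f≤g rewrite total-cons f | total-cons g =
  +-mono-≤ (f≤g zero) (total-mono (tail f) (tail g) (f≤g ∘ suc))

total-+ : ∀ {n} (f g : Seq n) → total (λ t → f t + g t) ≡ total f + total g
total-+ {zero} f g = refl
total-+ {suc n} f g rewrite total-cons (λ t → f t + g t) | total-cons f | total-cons g
  | total-+ (tail f) (tail g) =
  solve 4 (λ a b c e → (a :+ b) :+ (c :+ e) := (a :+ c) :+ (b :+ e)) refl
    (f zero) (g zero) (total (tail f)) (total (tail g))

total-update : ∀ {n} (f g : Seq n) (v : Fin n) → (∀ t → t ≢ v → f t ≡ g t) →
  total f + g v ≡ total g + f v
total-update {suc n} f g zero same rewrite total-cons f | total-cons g
  | total-cong (tail f) (tail g) (λ t → same (suc t) (λ ())) =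
  solve 3 (λ a b c → (a :+ c) :+ b := (b :+ c) :+ a) refl (f zero) (g zero) (total (tail g))
total-update {suc n} f g (suc v) same rewrite total-cons f | total-cons g | same zero (λ ()) =
  trans (+-assoc (g zero) (total (tail f)) (g (suc v)))
  (trans (cong (g zero +_) (total-update (tail f) (tail g) v
                              (λ t t≢v → same (suc t) (t≢v ∘ Fin.suc-injective))))
  (sym (+-assoc (g zero) (total (tail g)) (f (suc v)))))

positive-entry : ∀ {n} (f : Seq n) → 1 ≤ total f → Σ (Fin n) λ t → 1 ≤ f t
positive-entry {suc n} f 1≤total with f zero in eq | subst (1 ≤_) (total-cons f) 1≤total
... | suc _ | _ = zero , subst (1 ≤_) (sym eq) (s≤s z≤n)
... | zero | 1≤rest = let (t , 1≤ft) = positive-entry (tail f) 1≤rest in suc t , 1≤ft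

two-positive-entries : ∀ {n} (f : Seq n) → (∀ t → f t ≤ 1) → 2 ≤ total f →
  Σ (Fin n) λ t₁ → Σ (Fin n) λ t₂ → t₁ ≢ t₂ × 1 ≤ f t₁ × 1 ≤ f t₂
two-positive-entries {suc n} f f≤1 2≤total with f zero in eq | subst (2 ≤_) (total-cons f) 2≤total
... | zero | 2≤rest =
  let (t₁ , t₂ , t₁≢t₂ , p₁ , p₂) = two-positive-entries (tail f) (f≤1 ∘ suc) 2≤rest
  in suc t₁ , suc t₂ , t₁≢t₂ ∘ Fin.suc-injective , p₁ , p₂
... | suc zero | 2≤1+rest =
  let (t , p) = positive-entry (tail f) (s≤s⁻¹ 2≤1+rest)
  in zero , suc t , (λ ()) , subst (1 ≤_) (sym eq) (s≤s z≤n) , p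
... | suc (suc _) | _ with () ← s≤s⁻¹ (subst (_≤ 1) eq (f≤1 zero))

-- 2. Dominance as a sequence of unit transfers

record Transfer {n} (d d' : Seq n) : Set where
  field
    from to : Fin n
    gap      : 2 + d to ≤ d from
    loses    : suc (d' from) ≡ d from
    gains    : d' to ≡ suc (d to)
    others   : ∀ t → t ≢ from → t ≢ to → d' t ≡ d t

data Transfers {n} : Seq n → Seq n → Set where
  done : ∀ {d e} → (∀ t → d t ≡ e t) → Transfers d e
  step : ∀ {d d' e} → Transfer d d' → Transfers d' e → Transfers d e

transfer-congˡ : ∀ {n} {d₁ d₂ d' : Seq n} → (∀ t → d₁ t ≡ d₂ t) → Transfer d₁ d' → Transfer d₂ d'
transfer-congˡ d₁≗d₂ s = record
  { from = from ; to = to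
  ; gap = subst₂ (λ x y → 2 + x ≤ y) (d₁≗d₂ to) (d₁≗d₂ from) gap
  ; loses = trans loses (d₁≗d₂ from) ; gains = trans gains (cong suc (d₁≗d₂ to))
  ; others = λ t p q → trans (others t p q) (d₁≗d₂ t) }
  where open Transfer s

transfers-cong : ∀ {n} {d₁ d₂ e₁ e₂ : Seq n} → (∀ t → d₁ t ≡ d₂ t) → (∀ t → e₁ t ≡ e₂ t) →
  Transfers d₁ e₁ → Transfers d₂ e₂
transfers-cong d≗ e≗ (done eq) = done (λ t → trans (sym (d≗ t)) (trans (eq t) (e≗ t)))
transfers-cong d≗ e≗ (step s c) = step (transfer-congˡ d≗ s) (transfers-cong (λ _ → refl) e≗ c)

transfers-◂ : ∀ {n} h {d e : Seq n} → Transfers d e → Transfers (h ◂ d) (h ◂ e)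
transfers-◂ h (done eq) = done (λ { zero → refl ; (suc t) → eq t })
transfers-◂ h (step s c) = step lifted (transfers-◂ h c)
  where
  open Transfer s
  lifted : Transfer (h ◂ _) (h ◂ _)
  lifted = record
    { from = suc from ; to = suc to ; gap = gap ; loses = loses ; gains = gains
    ; others = λ { zero _ _ → refl
                 ; (suc t) p q → others t (p ∘ cong suc) (q ∘ cong suc) } }

-- `Covers k d e`: d with k extra units in front dominates e, i.e. the prefix sums of
-- e are at most k plus those of d and the totals agree.
Covers : ∀ {n} → ℕ → Seq n → Seq n → Set
Covers {zero} k d e = k ≡ 0
Covers {suc n} k d e = head e ≤ head d + k × Covers (head d + k ∸ head e) (tail d) (tail e)

covers-from-prefixes : ∀ {n} k (d e : Seq n) → total d + k ≡ total e →
  (∀ j → prefixSum e j ≤ k + prefixSum d j) → Covers k d e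
covers-from-prefixes {zero} k d e tot _ = tot
covers-from-prefixes {suc n} k d e tot pre = head-covered , covers-from-prefixes k' (tail d) (tail e) tot' pre'
  where
  x = head d
  y = head e
  head-covered : y ≤ x + k
  head-covered = subst₂ _≤_ (trans (prefixSum-cons e 0) (+-identityʳ y))
    (trans (cong (k +_) (trans (prefixSum-cons d 0) (+-identityʳ x))) (+-comm k x)) (pre 1)
  k' = x + k ∸ y
  k'+y : k' + y ≡ x + k
  k'+y = m∸n+n≡m head-covered
  tot' : total (tail d) + k' ≡ total (tail e)
  tot' = +-cancelˡ-≡ y _ _ (begin
    y + (total (tail d) + k')   ≡⟨ solve 3 (λ a b c → a :+ (b :+ c) := b :+ (c :+ a)) refl y (total (tail d)) k' ⟩
    total (tail d) + (k' + y)   ≡⟨ cong (total (tail d) +_) k'+y ⟩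
    total (tail d) + (x + k)    ≡⟨ solve 3 (λ a b c → a :+ (b :+ c) := (b :+ a) :+ c) refl (total (tail d)) x k ⟩
    (x + total (tail d)) + k    ≡⟨ cong (_+ k) (sym (total-cons d)) ⟩
    total d + k                 ≡⟨ tot ⟩
    total e                     ≡⟨ total-cons e ⟩
    y + total (tail e)          ∎)
    where open ≡-Reasoning
  pre' : ∀ j → prefixSum (tail e) j ≤ k' + prefixSum (tail d) j
  pre' j = +-cancelˡ-≤ y _ _ (begin
    y + prefixSum (tail e) j          ≡⟨ sym (prefixSum-cons e j) ⟩
    prefixSum e (suc j)               ≤⟨ pre (suc j) ⟩
    k + prefixSum d (suc j)           ≡⟨ cong (k +_) (prefixSum-cons d j) ⟩
    k + (x + prefixSum (tail d) j)    ≡⟨ solve 3 (λ a b c → a :+ (b :+ c) := (b :+ a) :+ c) refl k x (prefixSum (tail d) j) ⟩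
    (x + k) + prefixSum (tail d) j    ≡⟨ cong (_+ prefixSum (tail d) j) (sym k'+y) ⟩
    (k' + y) + prefixSum (tail d) j   ≡⟨ solve 3 (λ a b c → (a :+ b) :+ c := b :+ (a :+ c)) refl k' y (prefixSum (tail d) j) ⟩
    y + (k' + prefixSum (tail d) j)   ∎)
    where open ≤-Reasoning

find-deficit : ∀ {n} k (d e : Seq n) → Covers (suc k) d e →
  Σ (Fin n) λ b → d b < e b × Covers k (updateAt d b suc) e
find-deficit {suc n} k d e (head-covered , rest) with d zero <? e zero
... | yes short = zero , short , subst (e zero ≤_) (+-suc (d zero) k) head-covered
                    , subst (λ z → Covers (z ∸ e zero) (tail d) (tail e)) (+-suc (d zero) k) rest
... | no ¬short =
  let y≤x = ≮⇒≥ ¬short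
      y≤x+k = ≤-trans y≤x (m≤m+n (d zero) k)
      surplus = trans (cong (_∸ e zero) (+-suc (d zero) k)) (+-∸-assoc 1 y≤x+k)
      (b , d<e , covered) = find-deficit (d zero + k ∸ e zero) (tail d) (tail e)
                              (subst (λ z → Covers z (tail d) (tail e)) surplus rest)
  in suc b , d<e , y≤x+k , covered

mutual
  -- A head h + k above a tail that e bounds by h pays its surplus k into the tail,
  -- one unit at a time, each move having gap ≥ 2 because the receiver is below h.
  transfers-with-surplus : ∀ n k h (d e : Seq n) → Nonincreasing e → (∀ t → e t ≤ h) →
    Covers k d e → Transfers ((h + k) ◂ d) (h ◂ e)
  transfers-with-surplus n zero h d e e↓ e≤h covers =
    transfers-cong (λ { zero → sym (+-identityʳ h) ; (suc t) → refl }) (λ _ → refl)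
      (transfers-◂ h (transfers-from-covers n d e e↓ covers))
  transfers-with-surplus n (suc k) h d e e↓ e≤h covers with find-deficit k d e covers
  ... | b , d<e , covers' = step move (transfers-with-surplus n k h (updateAt d b suc) e e↓ e≤h covers')
    where
    move : Transfer ((h + suc k) ◂ d) ((h + k) ◂ updateAt d b suc)
    move = record
      { from = zero ; to = suc b
      ; gap = subst (2 + d b ≤_) (sym (+-suc h k)) (s≤s (≤-trans (≤-trans d<e (e≤h b)) (m≤m+n h k)))
      ; loses = sym (+-suc h k) ; gains = updateAt-updates b d
      ; others = λ { zero p _ → ⊥-elim (p refl)
                   ; (suc t) _ q → updateAt-minimal t b d (q ∘ cong suc) } }

  -- Without surplus, d₀ ≥ e₀; the excess d₀ - e₀ is paid into the tails as above.
  transfers-from-covers : ∀ n (d e : Seq n) → Nonincreasing e → Covers 0 d e → Transfers d e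
  transfers-from-covers zero d e _ _ = done (λ ())
  transfers-from-covers (suc n) d e e↓ (head-covered , rest) =
    transfers-cong
      (λ { zero → trans (+-comm (e zero) _) (trans (m∸n+n≡m head-covered) (+-identityʳ (d zero)))
         ; (suc t) → refl })
      (λ { zero → refl ; (suc t) → refl })
      (transfers-with-surplus n (d zero + 0 ∸ e zero) (e zero) (tail d) (tail e)
        (λ i j i<j → e↓ (suc i) (suc j) (s≤s i<j)) (λ t → e↓ zero (suc t) (s≤s z≤n)) rest)

dominance-transfers : ∀ {n} (d e : Seq n) → Nonincreasing e → d ⪰ e → Transfers d e
dominance-transfers {n} d e e↓ (tot , pre) =
  transfers-from-covers n d e e↓ (covers-from-prefixes 0 d e (trans (+-identityʳ _) tot) pre)

-- 3. Editing one pair of a graph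

bit : Bool → ℕ
bit true = 1
bit false = 0

length-filter-bit : ∀ {A : Set} (f : A → Bool) (xs : List A) →
  length (filter (λ x → T? (f x)) xs) ≡ sum (map (λ x → bit (f x)) xs)
length-filter-bit f [] = refl
length-filter-bit f (x ∷ xs) with f x
... | true = cong suc (length-filter-bit f xs)
... | false = length-filter-bit f xs

row : ∀ {n} → Graph n → Fin n → Seq n
row G x y = bit (adj G x y)

degree-row : ∀ {n} (G : Graph n) x → degree G x ≡ total (row G x)
degree-row {n} G x = length-filter-bit (adj G x) (allFin n)

Pair : ∀ {n} → Fin n → Fin n → Fin n → Fin n → Set
Pair u v x y = (x ≡ u × y ≡ v) ⊎ (x ≡ v × y ≡ u)

pair? : ∀ {n} (u v x y : Fin n) → Dec (Pair u v x y)
pair? u v x y = ((x ≟ u) ×-dec (y ≟ v)) ⊎-dec ((x ≟ v) ×-dec (y ≟ u))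

pair-swap : ∀ {n} {u v x y : Fin n} → Pair u v x y → Pair u v y x
pair-swap (inj₁ (p , q)) = inj₂ (q , p)
pair-swap (inj₂ (p , q)) = inj₁ (q , p)

pair-other : ∀ {n} {u v w w' t : Fin n} → u ≢ v → Pair u v w w' → Pair u v w t → t ≡ w'
pair-other u≢v (inj₁ (refl , refl)) (inj₁ (_ , refl)) = refl
pair-other u≢v (inj₁ (refl , refl)) (inj₂ (u≡v , _)) = ⊥-elim (u≢v u≡v)
pair-other u≢v (inj₂ (refl , refl)) (inj₁ (v≡u , _)) = ⊥-elim (u≢v (sym v≡u))
pair-other u≢v (inj₂ (refl , refl)) (inj₂ (_ , refl)) = refl

pair-partner : ∀ {n} {u w c c' x y : Fin n} → Pair u c x y → Pair w c' x y → c ≢ c' → c' ≡ u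
pair-partner (inj₁ (refl , refl)) (inj₁ (_ , refl)) c≢c' = ⊥-elim (c≢c' refl)
pair-partner (inj₁ (refl , refl)) (inj₂ (refl , _)) _ = refl
pair-partner (inj₂ (refl , refl)) (inj₁ (_ , refl)) _ = refl
pair-partner (inj₂ (refl , refl)) (inj₂ (refl , _)) c≢c' = ⊥-elim (c≢c' refl)

module _ {n} (G : Graph n) {u v : Fin n} (val : Bool) where
  setAdj : Fin n → Fin n → Bool
  setAdj x y = if does (pair? u v x y) then val else adj G x y

  setAdj-inside : ∀ {x y} → Pair u v x y → setAdj x y ≡ val
  setAdj-inside {x} {y} p = cong (if_then val else adj G x y) (dec-true (pair? u v x y) p)

  setAdj-outside : ∀ {x y} → ¬ Pair u v x y → setAdj x y ≡ adj G x y
  setAdj-outside {x} {y} ¬p = cong (if_then val else adj G x y) (dec-false (pair? u v x y) ¬p)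

  setAdj-sym : ∀ x y → setAdj x y ≡ setAdj y x
  setAdj-sym x y with pair? u v x y
  ... | yes p = trans (setAdj-inside p) (sym (setAdj-inside (pair-swap p)))
  ... | no ¬p = trans (setAdj-outside ¬p)
                  (trans (Graph.sym G x y) (sym (setAdj-outside (¬p ∘ pair-swap))))

  setAdj-loopless : u ≢ v → ∀ x → setAdj x x ≡ false
  setAdj-loopless u≢v x with pair? u v x x
  ... | yes (inj₁ (refl , u≡v)) = ⊥-elim (u≢v u≡v)
  ... | yes (inj₂ (u≡v , refl)) = ⊥-elim (u≢v u≡v)
  ... | no ¬p = trans (setAdj-outside ¬p) (loopless G x)

setPair : ∀ {n} (G : Graph n) {u v : Fin n} → u ≢ v → Bool → Graph n
setPair G u≢v val = record
  { adj = setAdj G val ; sym = setAdj-sym G val ; loopless = setAdj-loopless G val u≢v }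

module _ {n} (G : Graph n) {u v : Fin n} (u≢v : u ≢ v) (val : Bool) where
  private G' = setPair G u≢v val

  setPair-degree-outside : ∀ ℓ → ℓ ≢ u → ℓ ≢ v → degree G' ℓ ≡ degree G ℓ
  setPair-degree-outside ℓ ℓ≢u ℓ≢v = begin
    degree G' ℓ         ≡⟨ degree-row G' ℓ ⟩
    total (row G' ℓ)    ≡⟨ total-cong (row G' ℓ) (row G ℓ) (λ t → cong bit (setAdj-outside G val ℓ≢uv)) ⟩
    total (row G ℓ)     ≡⟨ degree-row G ℓ ⟨
    degree G ℓ          ∎
    where
    open ≡-Reasoning
    ℓ≢uv : ∀ {t} → ¬ Pair u v ℓ t
    ℓ≢uv (inj₁ (ℓ≡u , _)) = ℓ≢u ℓ≡u
    ℓ≢uv (inj₂ (ℓ≡v , _)) = ℓ≢v ℓ≡v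

  -- At an endpoint w of {u,v}, only the entry for the other endpoint w' changes.
  setPair-degree-endpoint : ∀ {w w'} → Pair u v w w' →
    degree G' w + bit (adj G u v) ≡ degree G w + bit val
  setPair-degree-endpoint {w} {w'} p = begin
    degree G' w + bit (adj G u v)         ≡⟨ cong₂ _+_ (degree-row G' w) (cong bit (same-pair p)) ⟩
    total (row G' w) + row G w w'         ≡⟨ total-update (row G' w) (row G w) w' off-w' ⟩
    total (row G w) + row G' w w'         ≡⟨ cong₂ _+_ (sym (degree-row G w)) (cong bit (setAdj-inside G val p)) ⟩
    degree G w + bit val                  ∎
    where
    open ≡-Reasoning
    same-pair : ∀ {w w'} → Pair u v w w' → adj G u v ≡ adj G w w'
    same-pair (inj₁ (refl , refl)) = refl
    same-pair (inj₂ (refl , refl)) = Graph.sym G u v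
    off-w' : ∀ t → t ≢ w' → row G' w t ≡ row G w t
    off-w' t t≢w' = cong bit (setAdj-outside G val (t≢w' ∘ pair-other u≢v p))

delete-degree : ∀ {n} (G : Graph n) {u v w w' : Fin n} (u≢v : u ≢ v) → Pair u v w w' →
  adj G u v ≡ true → suc (degree (setPair G u≢v false) w) ≡ degree G w
delete-degree G {u} {v} {w} u≢v p uv = begin
  suc (degree (setPair G u≢v false) w)     ≡⟨ +-comm 1 _ ⟩
  degree (setPair G u≢v false) w + 1       ≡⟨ cong (λ z → degree (setPair G u≢v false) w + bit z) uv ⟨
  degree (setPair G u≢v false) w + bit (adj G u v) ≡⟨ setPair-degree-endpoint G u≢v false p ⟩
  degree G w + 0                           ≡⟨ +-identityʳ _ ⟩
  degree G w                               ∎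
  where open ≡-Reasoning

add-degree : ∀ {n} (G : Graph n) {u v w w' : Fin n} (u≢v : u ≢ v) → Pair u v w w' →
  adj G u v ≡ false → degree (setPair G u≢v true) w ≡ suc (degree G w)
add-degree G {u} {v} {w} u≢v p uv = begin
  degree (setPair G u≢v true) w            ≡⟨ +-identityʳ _ ⟨
  degree (setPair G u≢v true) w + 0        ≡⟨ cong (λ z → degree (setPair G u≢v true) w + bit z) uv ⟨
  degree (setPair G u≢v true) w + bit (adj G u v) ≡⟨ setPair-degree-endpoint G u≢v true p ⟩
  degree G w + 1                           ≡⟨ +-comm _ 1 ⟩
  suc (degree G w)                         ∎
  where open ≡-Reasoning

-- 4. Private neighbours and the switch

module PrivateNeighbours {n} (G : Graph n) (a b : Fin n) where
  Private : Fin n → Set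
  Private c = adj G a c ≡ true × adj G b c ≡ false × c ≢ b

  private-≢ : ∀ {c} → Private c → c ≢ a
  private-≢ (a~c , _) refl with () ← trans (sym a~c) (loopless G a)

  privateBit : Seq n
  privateBit c with c ≟ b | adj G a c | adj G b c
  ... | no _ | true | false = 1
  ... | _    | _    | _     = 0

  privateBit≤1 : ∀ c → privateBit c ≤ 1
  privateBit≤1 c with c ≟ b | adj G a c | adj G b c
  ... | no _  | true  | false = ≤-refl
  ... | no _  | true  | true  = z≤n
  ... | no _  | false | _     = z≤n
  ... | yes _ | _     | _     = z≤n

  privateBit-private : ∀ c → 1 ≤ privateBit c → Private c
  privateBit-private c 1≤bit with c ≟ b | adj G a c | adj G b c
  ... | no c≢b | true  | false = refl , refl , c≢b
  ... | no _   | true  | true  with () ← 1≤bit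
  ... | no _   | false | _     with () ← 1≤bit
  ... | yes _  | _     | _     with () ← 1≤bit

  privateBit-bound : ∀ c → c ≢ b → row G a c ≤ privateBit c + row G b c
  privateBit-bound c c≢b with c ≟ b | adj G a c | adj G b c
  ... | yes c≡b | _     | _     = ⊥-elim (c≢b c≡b)
  ... | no _    | true  | false = ≤-refl
  ... | no _    | true  | true  = ≤-refl
  ... | no _    | false | _     = z≤n

  -- Counting: the neighbours of
  -- a other than b are private or common with b, and the common ones are
  -- neighbours of b other than a.  The shared term X = [a ~ b] is accounted for by
  -- raising the entry of a in its own row, and the entry of b in the bound, to X.
  two-private : a ≢ b → 2 + degree G b ≤ degree G a → 2 ≤ total privateBit
  two-private a≢b gap =
    +-cancelʳ-≤ (degree G b) 2 (total privateBit) (+-cancelʳ-≤ X _ _ (≤-trans (+-monoˡ-≤ X gap) counted))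
    where
    X = row G a b
    bound : Seq n
    bound c = privateBit c + row G b c
    raisedA raisedB : Seq n
    raisedA = updateAt (row G a) a (λ _ → X)
    raisedB = updateAt bound b (λ _ → X)

    raised≤ : ∀ c → raisedA c ≤ raisedB c
    raised≤ c with c ≟ a
    ... | yes refl = begin
      raisedA a              ≡⟨ updateAt-updates a (row G a) ⟩
      row G a b              ≡⟨ cong bit (Graph.sym G a b) ⟩
      row G b a              ≤⟨ m≤n+m _ _ ⟩
      bound a                ≡⟨ updateAt-minimal a b bound a≢b ⟨
      raisedB a              ∎
      where open ≤-Reasoning
    ... | no c≢a with c ≟ b
    ...   | yes refl = ≤-reflexive (trans (updateAt-minimal b a (row G a) (a≢b ∘ sym))
                                      (sym (updateAt-updates b bound)))
    ...   | no c≢b = subst₂ _≤_ (sym (updateAt-minimal c a (row G a) c≢a))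
                        (sym (updateAt-minimal c b bound c≢b)) (privateBit-bound c c≢b)

    counted : degree G a + X ≤ total privateBit + degree G b + X
    counted = begin
      degree G a + X                       ≡⟨ cong₂ _+_ (sym (degree-row G a)) (updateAt-updates a (row G a)) ⟨
      total (row G a) + raisedA a          ≡⟨ total-update raisedA (row G a) a
                                                (λ t t≢a → updateAt-minimal t a (row G a) t≢a) ⟨
      total raisedA + row G a a            ≡⟨ cong (λ z → total raisedA + bit z) (loopless G a) ⟩
      total raisedA + 0                    ≡⟨ +-identityʳ _ ⟩
      total raisedA                        ≤⟨ total-mono raisedA raisedB raised≤ ⟩
      total raisedB                        ≤⟨ m≤m+n _ _ ⟩
      total raisedB + bound b              ≡⟨ total-update raisedB bound b
                                                (λ t t≢b → updateAt-minimal t b bound t≢b) ⟩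
      total bound + raisedB b              ≡⟨ cong (total bound +_) (updateAt-updates b bound) ⟩
      total bound + X                      ≡⟨ cong (_+ X) (total-+ privateBit (row G b)) ⟩
      total privateBit + total (row G b) + X ≡⟨ cong (λ z → total privateBit + z + X) (degree-row G b) ⟨
      total privateBit + degree G b + X    ∎
      where open ≤-Reasoning

-- The pairs whose adjacency changes when the edge ac is replaced by bc.
Touched : ∀ {n} → Fin n → Fin n → Fin n → Fin n → Fin n → Set
Touched a b c i j = Pair a c i j ⊎ Pair b c i j

touched? : ∀ {n} (a b c i j : Fin n) → Dec (Touched a b c i j)
touched? a b c i j = pair? a c i j ⊎-dec pair? b c i j

touched-twice : ∀ {n} {a b c c' i j : Fin n} → c ≢ c' →
  Touched a b c i j → Touched a b c' i j → c' ≡ a ⊎ c' ≡ b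
touched-twice c≢c' (inj₁ p) (inj₁ q) = inj₁ (pair-partner p q c≢c')
touched-twice c≢c' (inj₁ p) (inj₂ q) = inj₁ (pair-partner p q c≢c')
touched-twice c≢c' (inj₂ p) (inj₁ q) = inj₂ (pair-partner p q c≢c')
touched-twice c≢c' (inj₂ p) (inj₂ q) = inj₂ (pair-partner p q c≢c')

module Switch {n} (G : Graph n) {a b c : Fin n}
  (a~c : adj G a c ≡ true) (b≁c : adj G b c ≡ false) (c≢b : c ≢ b) (c≢a : c ≢ a) where

  a≢b : a ≢ b
  a≢b refl with () ← trans (sym a~c) b≁c

  a≢c : a ≢ c
  a≢c = c≢a ∘ sym

  b≢c : b ≢ c
  b≢c = c≢b ∘ sym

  deleted switched : Graph n
  deleted = setPair G a≢c false
  switched = setPair deleted b≢c true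

  b≁c-deleted : adj deleted b c ≡ false
  b≁c-deleted = trans (setAdj-outside G false λ { (inj₁ (b≡a , _)) → a≢b (sym b≡a)
                                                 ; (inj₂ (b≡c , _)) → b≢c b≡c })
                      b≁c

  switched-realizes : ∀ {d d'} → Realizes G d → suc (d' a) ≡ d a → d' b ≡ suc (d b) →
    (∀ t → t ≢ a → t ≢ b → d' t ≡ d t) → Realizes switched d'
  switched-realizes {d} {d'} G⊨d loses gains others ℓ = by-cases ℓ (ℓ ≟ a) (ℓ ≟ b) (ℓ ≟ c)
    where
    -- decisions passed as arguments, since `with ℓ ≟ b` would also abstract the
    -- comparisons hidden inside the adjacency of the switched graph
    by-cases : ∀ ℓ → Dec (ℓ ≡ a) → Dec (ℓ ≡ b) → Dec (ℓ ≡ c) → degree switched ℓ ≡ d' ℓ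
    by-cases .a (yes refl) _ _ = suc-injective (begin
      suc (degree switched a)  ≡⟨ cong suc (setPair-degree-outside deleted b≢c true a a≢b a≢c) ⟩
      suc (degree deleted a)   ≡⟨ delete-degree G a≢c (inj₁ (refl , refl)) a~c ⟩
      degree G a               ≡⟨ G⊨d a ⟩
      d a                      ≡⟨ loses ⟨
      suc (d' a)               ∎)
      where open ≡-Reasoning
    by-cases .b (no ℓ≢a) (yes refl) _ = begin
      degree switched b        ≡⟨ add-degree deleted b≢c (inj₁ (refl , refl)) b≁c-deleted ⟩
      suc (degree deleted b)   ≡⟨ cong suc (setPair-degree-outside G a≢c false b ℓ≢a b≢c) ⟩
      suc (degree G b)         ≡⟨ cong suc (G⊨d b) ⟩
      suc (d b)                ≡⟨ gains ⟨
      d' b                     ∎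
      where open ≡-Reasoning
    by-cases .c (no ℓ≢a) (no ℓ≢b) (yes refl) = begin
      degree switched c        ≡⟨ add-degree deleted b≢c (inj₂ (refl , refl)) b≁c-deleted ⟩
      suc (degree deleted c)   ≡⟨ delete-degree G a≢c (inj₂ (refl , refl)) a~c ⟩
      degree G c               ≡⟨ G⊨d c ⟩
      d c                      ≡⟨ others c ℓ≢a ℓ≢b ⟨
      d' c                     ∎
      where open ≡-Reasoning
    by-cases ℓ (no ℓ≢a) (no ℓ≢b) (no ℓ≢c) = begin
      degree switched ℓ        ≡⟨ setPair-degree-outside deleted b≢c true ℓ ℓ≢b ℓ≢c ⟩
      degree deleted ℓ         ≡⟨ setPair-degree-outside G a≢c false ℓ ℓ≢a ℓ≢c ⟩
      degree G ℓ               ≡⟨ G⊨d ℓ ⟩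
      d ℓ                      ≡⟨ others ℓ ℓ≢a ℓ≢b ⟨
      d' ℓ                     ∎
      where open ≡-Reasoning

  switched-untouched : ∀ {i j} → ¬ Touched a b c i j → adj switched i j ≡ adj G i j
  switched-untouched ¬t = trans (setAdj-outside deleted true (¬t ∘ inj₂)) (setAdj-outside G false (¬t ∘ inj₁))

-- 5. Transferring forced pairs

AgreeingRealization : ∀ {n} → Fin n → Fin n → Graph n → Seq n → Set
AgreeingRealization {n} i j G e = Σ (Graph n) λ H → Realizes H e × adj H i j ≡ adj G i j

-- A transfer is mirrored by a switch at a private neighbour; of two distinct private
-- neighbours at least one gives a switch that does not touch {i,j}.
transfer-realization : ∀ {n} (i j : Fin n) {d d' : Seq n} (G : Graph n) → Realizes G d →
  Transfer d d' → AgreeingRealization i j G d'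
transfer-realization i j {d} {d'} G G⊨d t = choose
  where
  open Transfer t
  open PrivateNeighbours G from to

  from≢to : from ≢ to
  from≢to refl = 1+n≰n (≤-trans (n≤1+n _) gap)

  degree-gap : 2 + degree G to ≤ degree G from
  degree-gap = subst₂ (λ x y → 2 + x ≤ y) (sym (G⊨d to)) (sym (G⊨d from)) gap

  switch-at : ∀ c → Private c → ¬ Touched from to c i j → AgreeingRealization i j G d'
  switch-at c p@(a~c , b≁c , c≢b) ¬t =
    switched , switched-realizes G⊨d loses gains others , switched-untouched ¬t
    where open Switch G a~c b≁c c≢b (private-≢ p)

  choose : AgreeingRealization i j G d'
  choose with two-positive-entries privateBit privateBit≤1 (two-private from≢to degree-gap)
  ... | c₁ , c₂ , c₁≢c₂ , p₁ , p₂ with touched? from to c₁ i j | touched? from to c₂ i j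
  ...   | no ¬t₁ | _      = switch-at c₁ (privateBit-private c₁ p₁) ¬t₁
  ...   | yes _  | no ¬t₂ = switch-at c₂ (privateBit-private c₂ p₂) ¬t₂
  ...   | yes t₁ | yes t₂ with touched-twice c₁≢c₂ t₁ t₂ | privateBit-private c₂ p₂
  ...     | inj₁ c₂≡from | priv = ⊥-elim (private-≢ priv c₂≡from)
  ...     | inj₂ c₂≡to   | (_ , _ , c₂≢to) = ⊥-elim (c₂≢to c₂≡to)

transfers-realization : ∀ {n} (i j : Fin n) {d e : Seq n} → Transfers d e →
  (G : Graph n) → Realizes G d → AgreeingRealization i j G e
transfers-realization i j (done d≗e) G G⊨d = G , (λ ℓ → trans (G⊨d ℓ) (d≗e ℓ)) , refl
transfers-realization i j (step t ts) G G⊨d =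
  let (H , H⊨d' , H~G) = transfer-realization i j G G⊨d t
      (K , K⊨e , K~H) = transfers-realization i j ts H H⊨d'
  in K , K⊨e , trans K~H H~G

forced-adjacency : ∀ {n} (i j : Fin n) {d e : Seq n} {v : Bool} → Transfers d e →
  (∀ H → Realizes H e → adj H i j ≡ v) → ∀ G → Realizes G d → adj G i j ≡ v
forced-adjacency i j ts forced G G⊨d =
  let (H , H⊨e , H~G) = transfers-realization i j ts G G⊨d in trans (sym H~G) (forced H H⊨e)

theorem4p1 : ∀ (s n : ℕ) (d e : Seq n) (i j : Fin n) →
    InP s n d → InP s n e → Graphic d → Graphic e →
    i ≢ j → d ⪰ e → ForcedPair e i j → ForcedPair d i j
theorem4p1 s n d e i j _ (e↓ , _) _ _ _ d⪰e = transfer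
  where
  transfers : Transfers d e
  transfers = dominance-transfers d e e↓ d⪰e

  transfer : ForcedPair e i j → ForcedPair d i j
  transfer (edge forced) = edge (forced-adjacency i j transfers forced)
  transfer (nonEdge forced) = nonEdge (forced-adjacency i j transfers forced)
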